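{- Let $b,c$ be positive integers. A bipartite graph $G$ admits a $(b,c)$-coloring if and only if it admits a $(c,b)$-coloring.
   Context: A $(b,c)$-coloring of a graph is a 2-coloring of its vertices such that every vertex has exactly $b$ neighbors of its own color and exactly $c$ neighbors of the other color. -}

module Defs where

open import Data.Nat using (ℕ)
open import Data.Bool using (Bool; true; false; _∧_; not)
open import Data.Fin using (Fin)
open import Data.List using (List; filter; length; allFin)
open import Data.Product using (Σ; _×_)
open import Relation.Binary.PropositionalEquality using (_≡_)
open import Relation.Nullary using (¬_)
open import Relation.Nullary.Decidable using (does; yes; no; Dec)
open import Data.Bool.Properties using () renaming (_≟_ to _≟ᵇ_)
open import Relation.Unary using (Decidable)

record Graph (n : ℕ) : Set where
  field
    adj   : Fin n → Fin n → Bool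
    sym   : ∀ u v → adj u v ≡ adj v u
    irrefl : ∀ v → adj v v ≡ false

open Graph public

Coloring : ℕ → Set
Coloring n = Fin n → Bool

sameNbrs : ∀ {n} → Graph n → Coloring n → Fin n → ℕ
sameNbrs {n} G χ u =
  length (filter (λ v → (adj G u v ∧ does (χ v ≟ᵇ χ u)) ≟ᵇ true) (allFin n))

otherNbrs : ∀ {n} → Graph n → Coloring n → Fin n → ℕ
otherNbrs {n} G χ u =
  length (filter (λ v → (adj G u v ∧ not (does (χ v ≟ᵇ χ u))) ≟ᵇ true) (allFin n))

IsBCColoring : ∀ {n} → Graph n → ℕ → ℕ → Coloring n → Set
IsBCColoring G b c χ = ∀ u → (sameNbrs G χ u ≡ b) × (otherNbrs G χ u ≡ c)

AdmitsBC : ∀ {n} → Graph n → ℕ → ℕ → Set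
AdmitsBC {n} G b c = Σ (Coloring n) (IsBCColoring G b c)

Bipartite : ∀ {n} → Graph n → Set
Bipartite {n} G = Σ (Coloring n) λ χ → ∀ u v → adj G u v ≡ true → ¬ (χ u ≡ χ v)

{-# OPTIONS --safe #-}
-- If β is a proper 2-colouring of the bipartite graph and χ is a colouring,
-- then along every edge β changes value, so χ xor β agrees at the two ends of
-- an edge exactly when χ disagrees there.  Recolouring by χ xor β therefore
-- exchanges the counts of same-coloured and other-coloured neighbours, turning
-- a (b,c)-colouring into a (c,b)-colouring.
module Submission where

open import Defs hiding (sym)
open import Data.Nat using (ℕ; _≥_)
open import Data.Product using (_×_; _,_; proj₁; proj₂)
open import Data.Bool using (Bool; true; false; _∧_; not; _xor_)
open import Data.Bool.Properties using (not-involutive) renaming (_≟_ to _≟ᵇ_)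
open import Data.List using (List; filter; length; allFin)
open import Data.List.Properties using (filter-≐)
open import Relation.Binary.PropositionalEquality using (_≡_; _≢_; refl; sym; trans; cong)
open import Function using (_∘′_)
open import Relation.Nullary using (does; contradiction)

length-filter-≗ : ∀ {A : Set} (f g : A → Bool) → (∀ x → f x ≡ g x) → (xs : List A) →
  length (filter (λ x → f x ≟ᵇ true) xs) ≡ length (filter (λ x → g x ≟ᵇ true) xs)
length-filter-≗ f g f≗g xs =
  cong length (filter-≐ (λ x → f x ≟ᵇ true) (λ x → g x ≟ᵇ true)
                        ((λ {x} → trans (sym (f≗g x))) , (λ {x} → trans (f≗g x))) xs)

xor-≢-does-≟ : ∀ x y p q → p ≢ q → does (x xor p ≟ᵇ y xor q) ≡ not (does (x ≟ᵇ y))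
xor-≢-does-≟ _     _     false false p≢q = contradiction refl p≢q
xor-≢-does-≟ _     _     true  true  p≢q = contradiction refl p≢q
xor-≢-does-≟ false false false true  _   = refl
xor-≢-does-≟ false true  false true  _   = refl
xor-≢-does-≟ true  false false true  _   = refl
xor-≢-does-≟ true  true  false true  _   = refl
xor-≢-does-≟ false false true  false _   = refl
xor-≢-does-≟ false true  true  false _   = refl
xor-≢-does-≟ true  false true  false _   = refl
xor-≢-does-≟ true  true  true  false _   = refl

AgreementSwapped : ∀ {n} → Graph n → Coloring n → Coloring n → Set
AgreementSwapped G χ χ′ =
  ∀ u v → adj G u v ≡ true → does (χ′ v ≟ᵇ χ′ u) ≡ not (does (χ v ≟ᵇ χ u))

module _ {n} (G : Graph n) {χ χ′ : Coloring n} (swapped : AgreementSwapped G χ χ′) where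

  sameNbrs-swapped : ∀ u → sameNbrs G χ′ u ≡ otherNbrs G χ u
  sameNbrs-swapped u = length-filter-≗ _ _ edgewise (allFin n)
    where
    edgewise : ∀ v → (adj G u v ∧ does (χ′ v ≟ᵇ χ′ u)) ≡ (adj G u v ∧ not (does (χ v ≟ᵇ χ u)))
    edgewise v with adj G u v in uv
    ... | false = refl
    ... | true  = swapped u v uv

  otherNbrs-swapped : ∀ u → otherNbrs G χ′ u ≡ sameNbrs G χ u
  otherNbrs-swapped u = length-filter-≗ _ _ edgewise (allFin n)
    where
    edgewise : ∀ v → (adj G u v ∧ not (does (χ′ v ≟ᵇ χ′ u))) ≡ (adj G u v ∧ does (χ v ≟ᵇ χ u))
    edgewise v with adj G u v in uv
    ... | false = refl
    ... | true  = trans (cong not (swapped u v uv)) (not-involutive _)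

  isBCColoring-swapped : ∀ {b c} → IsBCColoring G b c χ → IsBCColoring G c b χ′
  isBCColoring-swapped isBC u =
    trans (sameNbrs-swapped u) (proj₂ (isBC u)) , trans (otherNbrs-swapped u) (proj₁ (isBC u))

xor-proper-swapped : ∀ {n} (G : Graph n) (β : Coloring n) →
  (∀ u v → adj G u v ≡ true → β u ≢ β v) →
  (χ : Coloring n) → AgreementSwapped G χ (λ v → χ v xor β v)
xor-proper-swapped G β proper χ u v uv = xor-≢-does-≟ (χ v) (χ u) (β v) (β u) (proper u v uv ∘′ sym)

admitsBC-swap : ∀ {n} (G : Graph n) → Bipartite G → ∀ {b c} → AdmitsBC G b c → AdmitsBC G c b
admitsBC-swap G (β , proper) (χ , isBC) =
  χ⊕β , isBCColoring-swapped G {χ} {χ⊕β} (xor-proper-swapped G β proper χ) isBC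
  where
  χ⊕β : Coloring _
  χ⊕β v = χ v xor β v

mainTheorem11 : ∀ (b c : ℕ) → b ≥ 1 → c ≥ 1 →
    ∀ {n : ℕ} (G : Graph n) → Bipartite G →
    (AdmitsBC G b c → AdmitsBC G c b) × (AdmitsBC G c b → AdmitsBC G b c)
mainTheorem11 b c _ _ G bipartite = admitsBC-swap G bipartite , admitsBC-swap G bipartite
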